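{- Let $\varepsilon=10^{ -5}$, let $0<\delta<\varepsilon/10$, let $\ell$ be a power of two, and let $w>\varepsilon^{ -2}\ell$. If $x$ is an $\ell$-fine binary string of length $w$ and $y$ is a binary string with $\mathrm{LCS}(x,y)\ge(1-\delta)w$, then $y_\ell=(0^\ell1^\ell)^{\varepsilon w/(5\ell)}$ is a subsequence of $y$.
   Context: $\mathrm{LCS}$ is the longest common (not necessarily contiguous) subsequence length. Intervals $I=[a,b]$ denote $\{a+1,\dots,b\}$, of length $b-a$, and $x_I=x_{a+1}\cdots x_b$. The density of a binary string is its fraction of ones; $I$ is $\gamma$-imbalanced in $x$ if $d(x_I)\notin[\frac12-\gamma,\frac12+\gamma]$. In a string $x$, an $\ell$-flag is an index $i$ such that between the $i$-th one and the $(i+\ell)$-th one of $x$ there are strictly more than $10(\ell-1)$ zeros; an $\ell^+$-flag is an index that is a $t$-flag for some power of two $t\ge\ell$. For $x\in\{0,1\}^w$ and $\ell$ a power of two in $[1,w]$: $x$ is $\ell$-coarse if $\ell\ge\varepsilon^2w$ and some interval of length $\ell$ is $\varepsilon^2$-imbalanced in $x$; $x$ is coarse if it is $\ell$-coarse for some such $\ell$; $x$ is $\ell$-fine if it is not coarse, $\ell<\varepsilon^2w$, the number of $\ell^+$-flags in $x$ is at least $\varepsilon w$, and $x$ contains $(0^\ell1^\ell)^{\varepsilon w/\ell}$ as a subsequence.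
   Formalization: The parameter δ ranges over the rationals. -}

module Defs where

open import Data.Bool using (Bool; true; false)
open import Data.Nat using (ℕ; zero; suc; _+_; _*_; _∸_; _^_; _≤_; _<_)
open import Data.Nat.DivMod using (_/_)
open import Data.List using (List; []; _∷_; length; take; drop; filter; replicate; _++_; concat; lookup)
open import Data.List.Relation.Binary.Sublist.Propositional using (_⊆_)
open import Data.List.Relation.Unary.All using (All)
open import Data.List.Relation.Unary.Unique.Propositional using (Unique)
open import Data.Product using (Σ; _×_; ∃; ∃-syntax; _,_)
open import Data.Sum using (_⊎_)
open import Relation.Binary.PropositionalEquality using (_≡_)
open import Relation.Nullary using (¬_)
open import Data.Fin using (Fin)

-- Binary strings: lists of booleans, true = 1, false = 0.
BStr : Set
BStr = List Bool

-- ε = 1/E with E = 10^5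
E : ℕ
E = 100000

divℕ : ℕ → ℕ → ℕ
divℕ m zero = 0
divℕ m (suc d) = m / suc d

PowerOfTwo : ℕ → Set
PowerOfTwo n = ∃[ k ] n ≡ 2 ^ k

ones : BStr → ℕ
ones [] = 0
ones (true ∷ s) = suc (ones s)
ones (false ∷ s) = ones s

zeros : BStr → ℕ
zeros [] = 0
zeros (true ∷ s) = zeros s
zeros (false ∷ s) = suc (zeros s)

-- x_I for I = [a,b] : x_{a+1} ... x_b
slice : BStr → ℕ → ℕ → BStr
slice x a b = take (b ∸ a) (drop a x)

-- s is γ-imbalanced with γ = gn/gd (gd > 0), density d = ones s / length s:
-- d < 1/2 - γ  or  d > 1/2 + γ, cleared of denominators (2·gd·length s > 0).
Imbalanced : ℕ → ℕ → BStr → Set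
Imbalanced gn gd s =
  (2 * gd * ones s + 2 * gn * length s < gd * length s)
  ⊎ (gd * length s + 2 * gn * length s < 2 * gd * ones s)

-- 1-indexed positions of the ones of x (in increasing order)
onePosFrom : ℕ → BStr → List ℕ
onePosFrom p [] = []
onePosFrom p (true ∷ s) = suc p ∷ onePosFrom (suc p) s
onePosFrom p (false ∷ s) = onePosFrom (suc p) s

onePos : BStr → List ℕ
onePos = onePosFrom 0

-- i is an ℓ-flag in x: 1 ≤ i, the (i+ℓ)-th one exists, and strictly more
-- than 10(ℓ-1) zeros lie strictly between the i-th one (position p) and
-- the (i+ℓ)-th one (position q), i.e. in x_[p, q-1].
Flag : BStr → ℕ → ℕ → Set
Flag x ℓ i =
  Σ (Fin (length (onePos x))) λ j → Σ (Fin (length (onePos x))) λ j' →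
    (Data.Fin.toℕ j ≡ i ∸ 1) × (Data.Fin.toℕ j' ≡ i + ℓ ∸ 1) × (1 ≤ i) ×
    (10 * (ℓ ∸ 1) < zeros (slice x (lookup (onePos x) j) (lookup (onePos x) j' ∸ 1)))

PlusFlag : BStr → ℕ → ℕ → Set
PlusFlag x ℓ i = ∃[ t ] (PowerOfTwo t × ℓ ≤ t × Flag x t i)

-- "the number of ℓ⁺-flags in x is at least εw": there are (at least)
-- that many distinct ℓ⁺-flags.  ε w ≤ n  ⇔  w ≤ E * n.
ManyPlusFlags : BStr → ℕ → ℕ → Set
ManyPlusFlags x ℓ w = ∃[ F ] (Unique F × All (PlusFlag x ℓ) F × w ≤ E * length F)

block : ℕ → ℕ → BStr
block ℓ zero = []
block ℓ (suc r) = replicate ℓ false ++ replicate ℓ true ++ block ℓ r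

-- x (of length w) is ℓ-coarse: ℓ power of two in [1,w], ℓ ≥ ε² w,
-- and some interval of length ℓ in [0,w] is ε²-imbalanced in x.
Coarse' : BStr → ℕ → ℕ → Set
Coarse' x w ℓ = PowerOfTwo ℓ × 1 ≤ ℓ × ℓ ≤ w × w ≤ E * E * ℓ ×
  ∃[ a ] (a + ℓ ≤ w × Imbalanced 1 (E * E) (slice x a (a + ℓ)))

Coarse : BStr → ℕ → Set
Coarse x w = ∃[ ℓ ] Coarse' x w ℓ

Fine : BStr → ℕ → ℕ → Set
Fine x w ℓ = PowerOfTwo ℓ × 1 ≤ ℓ × ℓ ≤ w ×
  ¬ Coarse x w × E * E * ℓ < w × ManyPlusFlags x ℓ w ×
  block ℓ (divℕ w (E * ℓ)) ⊆ x

LCS≥ : BStr → BStr → ℕ → Set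
LCS≥ x y k = ∃[ z ] (z ⊆ x × z ⊆ y × k ≤ length z)

-- Charge a
-- labelling of the letters of a string by bits one per letter equal to its label and ℓ per change
-- of label; the least charge is at least ℓR on every supersequence of B.  Embed (0^ℓ1^ℓ)^r greedily
-- into a common subsequence z of x and y of length ≥ (1-δ)w: if this fails, following the least
-- charge along x shows that more than ℓR - 4ℓr ≈ εw/5 letters of x are missing from z, whereas at
-- most δw < εw/10 are.
module Submission where

open import Defs
open import Data.Bool using (Bool; true; false; not; _≟_)
open import Data.Empty using (⊥; ⊥-elim)
open import Data.List using ([]; _∷_; length; replicate; _++_)
open import Data.List.Relation.Binary.Sublist.Propositional using (_⊆_; []; _∷_; _∷ʳ_; minimum; ⊆-trans)
open import Data.Nat using (ℕ; zero; suc; _+_; _*_; _∸_; _⊓_; _≤_; _<_; z≤n; s≤s)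
open import Data.Nat.DivMod using (_/_; _%_; m/n*n≤m; m%n<n; m≡m%n+[m/n]*n)
open import Data.Nat.Properties
  using ( ≤-refl; ≤-trans; <⇒≤; ≤-pred; <-irrefl; n≤1+n; m≤m+n; m≤n+m∸n; ≤ᵇ⇒≤; module ≤-Reasoning
        ; +-comm; +-suc; +-identityʳ; *-assoc; *-suc; *-zeroʳ; *-distribˡ-+; *-distribʳ-+
        ; +-monoˡ-≤; +-monoʳ-≤; +-mono-≤; +-monoˡ-<; *-monoˡ-≤; *-monoʳ-≤; *-mono-≤; *-monoʳ-<
        ; +-cancelʳ-≤; *-cancelˡ-≤; +-commutativeSemigroup
        ; m⊓n≤m; m⊓n≤n; ⊓-glb; ⊓-mono-≤; +-distribʳ-⊓ )
open import Algebra.Properties.CommutativeSemigroup +-commutativeSemigroup using (xy∙z≈xz∙y)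
open import Data.Nat.Tactic.RingSolver using (solve-∀)
open import Data.Product using (_×_; _,_; ∃-syntax)
open import Data.Sum using (_⊎_; inj₁; inj₂)
open import Relation.Binary.PropositionalEquality using (_≡_; _≢_; refl; sym; trans; cong; subst)
open import Relation.Nullary using (yes; no)

m≤n+o⇒m≤[1+n]⊓[m+o]+o : ∀ {m n o} → m ≤ n + o → m ≤ suc n ⊓ (m + o) + o
m≤n+o⇒m≤[1+n]⊓[m+o]+o {m} {n} {o} m≤n+o = subst (m ≤_) (sym (+-distribʳ-⊓ o (suc n) (m + o)))
  (⊓-glb (≤-trans m≤n+o (+-monoˡ-≤ o (n≤1+n n))) (≤-trans (m≤m+n m o) (m≤m+n (m + o) o)))

module _ (ℓ : ℕ) where

  -- The least charge of a labelling of the letters of p by bits, starting from label b: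
  -- one per letter equal to its label and ℓ per change of label.  For a letter other than b
  -- the second option, cost (not b) p + 1 + ℓ, is dropped as cost-switch makes it redundant.
  cost : Bool → BStr → ℕ
  cost b [] = 0
  cost false (false ∷ p) = suc (cost false p) ⊓ (cost true p + ℓ)
  cost true (true ∷ p) = suc (cost true p) ⊓ (cost false p + ℓ)
  cost false (true ∷ p) = cost false p
  cost true (false ∷ p) = cost true p

  cost-self : ∀ c p → cost c (c ∷ p) ≡ suc (cost c p) ⊓ (cost (not c) p + ℓ)
  cost-self false p = refl
  cost-self true p = refl

  cost-other : ∀ c p → cost (not c) (c ∷ p) ≡ cost (not c) p
  cost-other false p = refl
  cost-other true p = refl

  cost-switch : ∀ b p → cost b p ≤ cost (not b) p + ℓ
  cost-switch b [] = z≤n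
  cost-switch false (false ∷ p) = m⊓n≤n _ _
  cost-switch true (true ∷ p) = m⊓n≤n _ _
  cost-switch false (true ∷ p) = m≤n+o⇒m≤[1+n]⊓[m+o]+o (cost-switch false p)
  cost-switch true (false ∷ p) = m≤n+o⇒m≤[1+n]⊓[m+o]+o (cost-switch true p)

  cost-∷-≤ : ∀ b c p → cost b (c ∷ p) ≤ suc (cost b p)
  cost-∷-≤ false false p = m⊓n≤m _ _
  cost-∷-≤ true true p = m⊓n≤m _ _
  cost-∷-≤ false true p = n≤1+n _
  cost-∷-≤ true false p = n≤1+n _

  cost-∷-≢ : ∀ {b c} p → c ≢ b → cost b (c ∷ p) ≡ cost b p
  cost-∷-≢ {false} {false} p c≢b = ⊥-elim (c≢b refl)
  cost-∷-≢ {true} {true} p c≢b = ⊥-elim (c≢b refl)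
  cost-∷-≢ {false} {true} p _ = refl
  cost-∷-≢ {true} {false} p _ = refl

  cost-≤-∷ : ∀ b c p → cost b p ≤ cost b (c ∷ p)
  cost-≤-∷ false false p = ⊓-glb (n≤1+n _) (cost-switch false p)
  cost-≤-∷ true true p = ⊓-glb (n≤1+n _) (cost-switch true p)
  cost-≤-∷ false true p = ≤-refl
  cost-≤-∷ true false p = ≤-refl

  cost-mono : ∀ {p q} → p ⊆ q → ∀ b → cost b p ≤ cost b q
  cost-mono [] b = z≤n
  cost-mono {q = c ∷ q} (.c ∷ʳ σ) b = ≤-trans (cost-mono σ b) (cost-≤-∷ b c q)
  cost-mono {false ∷ _} (refl ∷ σ) false = ⊓-mono-≤ (s≤s (cost-mono σ false)) (+-monoˡ-≤ ℓ (cost-mono σ true))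
  cost-mono {true ∷ _} (refl ∷ σ) true = ⊓-mono-≤ (s≤s (cost-mono σ true)) (+-monoˡ-≤ ℓ (cost-mono σ false))
  cost-mono {false ∷ _} (refl ∷ σ) true = cost-mono σ true
  cost-mono {true ∷ _} (refl ∷ σ) false = cost-mono σ false

  cost-replicate-other : ∀ c n q → cost (not c) (replicate n c ++ q) ≡ cost (not c) q
  cost-replicate-other c zero q = refl
  cost-replicate-other c (suc n) q = trans (cost-other c _) (cost-replicate-other c n q)

  cost-replicate-self : ∀ c {k} n q → n ≤ ℓ → k ≤ cost c q + n → k ≤ cost (not c) q + ℓ →
                        k ≤ cost c (replicate n c ++ q)
  cost-replicate-self c zero q _ k≤ _ = subst (_ ≤_) (+-identityʳ _) k≤
  cost-replicate-self c {zero} (suc n) q _ _ _ = z≤n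
  cost-replicate-self c {suc k} (suc n) q n<ℓ k<c+n k<c'+ℓ rewrite cost-self c (replicate n c ++ q) =
    ⊓-glb (s≤s (cost-replicate-self c n q (<⇒≤ n<ℓ)
                  (≤-pred (subst (suc k ≤_) (+-suc _ n) k<c+n)) (≤-trans (n≤1+n k) k<c'+ℓ)))
          (subst (λ t → suc k ≤ t + ℓ) (sym (cost-replicate-other c n q)) k<c'+ℓ)

  cost-block : ∀ R b → ℓ * R ≤ cost b (block ℓ R)
  cost-block zero b = subst (_≤ 0) (sym (*-zeroʳ ℓ)) z≤n
  cost-block (suc R) b rewrite *-suc ℓ R = cost-block-suc b
    where
      rest = block ℓ R
      a = ℓ * R
      ones++rest = replicate ℓ true ++ rest
      shift : ∀ {c} → a ≤ c → ℓ + a ≤ c + ℓ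
      shift {c} a≤c = subst (ℓ + a ≤_) (+-comm ℓ c) (+-monoʳ-≤ ℓ a≤c)
      false-ones : a ≤ cost false ones++rest
      false-ones = subst (a ≤_) (sym (cost-replicate-other true ℓ rest)) (cost-block R false)
      true-ones : ℓ + a ≤ cost true ones++rest
      true-ones = cost-replicate-self true ℓ rest ≤-refl (shift (cost-block R true)) (shift (cost-block R false))
      cost-block-suc : ∀ b → ℓ + a ≤ cost b (replicate ℓ false ++ ones++rest)
      cost-block-suc false = cost-replicate-self false ℓ ones++rest ≤-refl
        (shift false-ones) (≤-trans true-ones (m≤m+n _ ℓ))
      cost-block-suc true = subst (ℓ + a ≤_) (sym (cost-replicate-other false ℓ ones++rest)) true-ones

  alternating : Bool → ℕ → BStr
  alternating c zero = []
  alternating c (suc K) = replicate ℓ c ++ alternating (not c) K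

  alternating-block : ∀ r → alternating false (2 * r) ≡ block ℓ r
  alternating-block zero = refl
  alternating-block (suc r) = subst (λ n → alternating false n ≡ block ℓ (suc r)) (sym (*-suc 2 r))
    (cong (λ t → replicate ℓ false ++ replicate ℓ true ++ t) (alternating-block r))

  greedy-embedding : ∀ {z x} → z ⊆ x → ∀ b e K →
    replicate e b ++ alternating (not b) K ⊆ z ⊎ cost b x + length z < length x + e + 2 * (ℓ * K)
  greedy-embedding σ b zero zero = inj₁ (minimum _)
  greedy-embedding {z} {x} σ b zero (suc K) with greedy-embedding σ (not b) ℓ K
  ... | inj₁ t = inj₁ t
  ... | inj₂ h = inj₂ (begin-strict
      cost b x + length z               ≤⟨ +-monoˡ-≤ (length z) (cost-switch b x) ⟩
      cost (not b) x + ℓ + length z     ≡⟨ xy∙z≈xz∙y (cost (not b) x) ℓ (length z) ⟩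
      cost (not b) x + length z + ℓ     <⟨ +-monoˡ-< ℓ h ⟩
      length x + ℓ + 2 * (ℓ * K) + ℓ    ≡⟨ budget (length x) ℓ K ⟩
      length x + 0 + 2 * (ℓ * suc K)    ∎)
    where
      open ≤-Reasoning
      budget : ∀ n l K → n + l + 2 * (l * K) + l ≡ n + 0 + 2 * (l * suc K)
      budget = solve-∀
  greedy-embedding [] b (suc e) K = inj₂ (s≤s z≤n)
  greedy-embedding (c ∷ʳ σ) b (suc e) K with greedy-embedding σ b (suc e) K
  ... | inj₁ t = inj₁ t
  ... | inj₂ h = inj₂ (s≤s (≤-trans (+-monoˡ-≤ _ (cost-∷-≤ b c _)) h))
  greedy-embedding {c ∷ z} {c ∷ x} (refl ∷ σ) b (suc e) K with c ≟ b
  ... | yes refl with greedy-embedding σ b e K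
  ...   | inj₁ t = inj₁ (refl ∷ t)
  ...   | inj₂ h = inj₂ (s≤s (begin
      cost b (b ∷ x) + suc (length z)   ≡⟨ +-suc _ (length z) ⟩
      suc (cost b (b ∷ x) + length z)   ≤⟨ s≤s (+-monoˡ-≤ _ (cost-∷-≤ b b x)) ⟩
      suc (suc (cost b x) + length z)   ≤⟨ s≤s h ⟩
      suc (length x + e + 2 * (ℓ * K))  ≡⟨ cong (_+ 2 * (ℓ * K)) (sym (+-suc (length x) e)) ⟩
      length x + suc e + 2 * (ℓ * K)    ∎))
    where open ≤-Reasoning
  greedy-embedding {c ∷ z} {c ∷ x} (refl ∷ σ) b (suc e) K | no c≢b with greedy-embedding σ b (suc e) K
  ...   | inj₁ t = inj₁ (c ∷ʳ t)
  ...   | inj₂ h = inj₂ (s≤s (begin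
      cost b (c ∷ x) + suc (length z)   ≡⟨ cong (_+ suc (length z)) (cost-∷-≢ x c≢b) ⟩
      cost b x + suc (length z)         ≡⟨ +-suc _ (length z) ⟩
      suc (cost b x + length z)         ≤⟨ h ⟩
      length x + suc e + 2 * (ℓ * K)    ∎))
    where open ≤-Reasoning

  block-⊆⊎deletions : ∀ R r {x z} → block ℓ R ⊆ x → z ⊆ x →
    block ℓ r ⊆ z ⊎ ℓ * R + length z < length x + 4 * (ℓ * r)
  block-⊆⊎deletions R r {x} {z} B⊆x z⊆x with greedy-embedding z⊆x true 0 (2 * r)
  ... | inj₁ t = inj₁ (subst (_⊆ z) (alternating-block r) t)
  ... | inj₂ h = inj₂ (begin-strict
      ℓ * R + length z                   ≤⟨ +-monoˡ-≤ (length z) (≤-trans (cost-block R true) (cost-mono B⊆x true)) ⟩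
      cost true x + length z             <⟨ h ⟩
      length x + 0 + 2 * (ℓ * (2 * r))  ≡⟨ budget (length x) ℓ r ⟩
      length x + 4 * (ℓ * r)             ∎)
    where
      open ≤-Reasoning
      budget : ∀ n l r → n + 0 + 2 * (l * (2 * r)) ≡ n + 4 * (l * r)
      budget = solve-∀

divℕ-*-≤ : ∀ m n → divℕ m n * n ≤ m
divℕ-*-≤ m zero = z≤n
divℕ-*-≤ m (suc n) = m/n*n≤m m (suc n)

<-divℕ-*-+ : ∀ m n → 0 < n → m < divℕ m n * n + n
<-divℕ-*-+ m (suc n) _ = begin-strict
    m                                ≡⟨ m≡m%n+[m/n]*n m (suc n) ⟩
    m % suc n + m / suc n * suc n    <⟨ +-monoˡ-< _ (m%n<n m (suc n)) ⟩
    suc n + m / suc n * suc n        ≡⟨ +-comm (suc n) _ ⟩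
    m / suc n * suc n + suc n        ∎
  where open ≤-Reasoning

few-deletions : ∀ e p q w k n → 10 * e * p < q → (q ∸ p) * w ≤ q * k → k ≤ n →
                10 * e * w ≤ w + 10 * e * n
few-deletions e p q@(suc _) w k n 10ep<q qk≥ k≤n = *-cancelˡ-≤ q (begin
    q * (10 * e * w)                   ≡⟨ pull-q e q w ⟩
    10 * e * (q * w)                   ≤⟨ *-monoʳ-≤ (10 * e) qw≤ ⟩
    10 * e * (p * w + q * n)           ≡⟨ expand e p q w n ⟩
    10 * e * p * w + q * (10 * e * n)  ≤⟨ +-monoˡ-≤ _ (*-monoˡ-≤ w (<⇒≤ 10ep<q)) ⟩
    q * w + q * (10 * e * n)           ≡⟨ *-distribˡ-+ q w _ ⟨
    q * (w + 10 * e * n)               ∎)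
  where
    open ≤-Reasoning
    pull-q : ∀ e q w → q * (10 * e * w) ≡ 10 * e * (q * w)
    pull-q = solve-∀
    expand : ∀ e p q w n → 10 * e * (p * w + q * n) ≡ 10 * e * p * w + q * (10 * e * n)
    expand = solve-∀
    qw≤ : q * w ≤ p * w + q * n
    qw≤ = begin
      q * w               ≤⟨ *-monoˡ-≤ w (m≤n+m∸n q p) ⟩
      (p + (q ∸ p)) * w   ≡⟨ *-distribʳ-+ w p (q ∸ p) ⟩
      p * w + (q ∸ p) * w ≤⟨ +-monoʳ-≤ (p * w) (≤-trans qk≥ (*-monoʳ-≤ q k≤n)) ⟩
      p * w + q * n       ∎

deletions-budget-exceeded : ∀ e ℓ w R r n →
  ℓ * R + n < w + 4 * (ℓ * r) → 10 * e * w ≤ w + 10 * e * n →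
  w < R * (e * ℓ) + e * ℓ → r * (5 * e * ℓ) ≤ w → 10 * e * ℓ ≤ w → ⊥
deletions-budget-exceeded e ℓ w R r n deficit few w<[R+1]eℓ 5eℓr≤w 10eℓ≤w = <-irrefl refl (begin-strict
    10 * w                             <⟨ *-monoʳ-< 10 w<[R+1]eℓ ⟩
    10 * (R * (e * ℓ) + e * ℓ)         ≡⟨ *-distribˡ-+ 10 (R * (e * ℓ)) (e * ℓ) ⟩
    10 * (R * (e * ℓ)) + 10 * (e * ℓ)  ≤⟨ +-mono-≤ 10Reℓ≤9w (subst (_≤ w) (*-assoc 10 e ℓ) 10eℓ≤w) ⟩
    9 * w + w                          ≡⟨ +-comm (9 * w) w ⟩
    10 * w                             ∎)
  where
    open ≤-Reasoning
    lhs : ∀ e ℓ R n → 10 * e * (ℓ * R + n) ≡ 10 * (R * (e * ℓ)) + 10 * e * n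
    lhs = solve-∀
    rhs : ∀ e ℓ w r → 10 * e * (w + 4 * (ℓ * r)) ≡ 10 * e * w + 8 * (r * (5 * e * ℓ))
    rhs = solve-∀
    total : ∀ e w n → w + 10 * e * n + 8 * w ≡ 9 * w + 10 * e * n
    total = solve-∀
    10Reℓ≤9w : 10 * (R * (e * ℓ)) ≤ 9 * w
    10Reℓ≤9w = +-cancelʳ-≤ (10 * e * n) _ _ (begin
      10 * (R * (e * ℓ)) + 10 * e * n     ≡⟨ lhs e ℓ R n ⟨
      10 * e * (ℓ * R + n)                ≤⟨ *-monoʳ-≤ (10 * e) (<⇒≤ deficit) ⟩
      10 * e * (w + 4 * (ℓ * r))          ≡⟨ rhs e ℓ w r ⟩
      10 * e * w + 8 * (r * (5 * e * ℓ))  ≤⟨ +-mono-≤ few (*-monoʳ-≤ 8 5eℓr≤w) ⟩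
      w + 10 * e * n + 8 * w              ≡⟨ total e w n ⟩
      9 * w + 10 * e * n                  ∎)

block-⊆-of-LCS : ∀ e → 10 ≤ e → ∀ p q ℓ w (x y : BStr) → 10 * e * p < q → e * e * ℓ < w → 1 ≤ ℓ →
  length x ≡ w → block ℓ (divℕ w (e * ℓ)) ⊆ x → (∃[ k ] ((q ∸ p) * w ≤ q * k × LCS≥ x y k)) →
  block ℓ (divℕ w (5 * e * ℓ)) ⊆ y
block-⊆-of-LCS e 10≤e p q ℓ w x y 10ep<q e²ℓ<w 1≤ℓ refl B⊆x (k , qk≥ , z , z⊆x , z⊆y , k≤z)
  with block-⊆⊎deletions ℓ (divℕ w (e * ℓ)) (divℕ w (5 * e * ℓ)) B⊆x z⊆x
... | inj₁ B⊆z = ⊆-trans B⊆z z⊆y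
... | inj₂ deficit = ⊥-elim (deletions-budget-exceeded e ℓ w _ _ (length z) deficit
      (few-deletions e p q w k (length z) 10ep<q qk≥ k≤z)
      (<-divℕ-*-+ w (e * ℓ) (*-mono-≤ (≤-trans (s≤s z≤n) 10≤e) 1≤ℓ))
      (divℕ-*-≤ w (5 * e * ℓ))
      (≤-trans (*-monoˡ-≤ ℓ (*-monoˡ-≤ e 10≤e)) (<⇒≤ e²ℓ<w)))

lemma4 : (p q ℓ w : ℕ) (x y : BStr) →
    0 < p → 10 * E * p < q →
    PowerOfTwo ℓ → E * E * ℓ < w →
    length x ≡ w → Fine x w ℓ →
    (∃[ k ] ((q ∸ p) * w ≤ q * k × LCS≥ x y k)) →
    block ℓ (divℕ w (5 * E * ℓ)) ⊆ y
lemma4 p q ℓ w x y _ 10Ep<q _ E²ℓ<w |x|≡w (_ , 1≤ℓ , _ , _ , _ , _ , B⊆x) =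
  block-⊆-of-LCS E (≤ᵇ⇒≤ 10 E _) p q ℓ w x y 10Ep<q E²ℓ<w 1≤ℓ |x|≡w B⊆x
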